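{- Let $(\mathcal{U},\mathcal{C},k)$ be a Set Cover instance with $\mathcal{U}=\{e_1,\dots,e_n\}$, $\mathcal{C}=\{C_1,\dots,C_m\}$, $C_j\subseteq\mathcal{U}$, and integer $k>1$, and let $I'$ be the $\textsc{MinSumC}$ instance constructed from it as in the context, with $k'=(k+1)n$. If there is a set cover $T\subseteq\mathcal{C}$ (i.e. $\bigcup_{C\in T}C=\mathcal{U}$) with $|T|\le k$, then $I'$ admits an $\mathcal{A}$-perfect envy-free matching $M$ with $c(M)\le k'$.
   Context: $\textsc{MinSumC}$ instance: agents $\mathcal{A}$, programs $\mathcal{P}$, acceptable pairs $E$, strict preference orders of each agent over its acceptable programs and of each program over its acceptable agents, and a non-negative integer cost $c(p)$ per program (no capacity limits). A matching $M\subseteq E$ has each agent in at most one pair; $M(a)$ is $a$'s partner or $\bot$, with every acceptable program preferred to $\bot$. $M$ is envy-free if there are no $(a,p)\in M$ and agent $a'$ acceptable to $p$ with $a'\succ_p a$ and $p\succ_{a'}M(a')$; $\mathcal{A}$-perfect if all agents are matched; $c(M)=\sum_{(a,p)\in M}c(p)$. Construction of $I'$: for each element $e_i$ an element-agent $a_i$; for each set $C_j$ a subset-program $c_j$ with cost $1$, and $n$ dummy agents $u_j^1,\dots,u_j^n$ and $n$ dummy programs $w_j^1,\dots,w_j^n$ with cost $0$. Preferences: $a_i$ ranks exactly the programs $\{c_j: e_i\in C_j\}$ in a fixed arbitrary order; $u_j^l: c_j\succ w_j^l$; $c_j$ ranks all of $u_j^1,\dots,u_j^n$ (fixed arbitrary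 order) above all agents in $\{a_i: e_i\in C_j\}$ (fixed arbitrary order); $w_j^l$ ranks only $u_j^l$. -}

module Defs where

open import Data.Nat using (ℕ; zero; suc; _+_; _<_)
open import Data.Fin using (Fin)
open import Data.Fin.Subset using (Subset; _∈_)
open import Data.List using (List; []; _∷_; map; concatMap; allFin)
open import Data.Nat.ListAction using (sum)
open import Data.Maybe using (Maybe; just; nothing)
open import Data.Product using (Σ; ∃; _×_)
open import Data.Unit using (⊤)
open import Data.Empty using (⊥)
open import Relation.Binary.PropositionalEquality using (_≡_)

record MinSumC : Set₁ where
  field
    Agent      : Set
    Program    : Set
    -- an enumeration listing every agent exactly once (used for the cost sum)
    agents     : List Agent
    Acceptable : Agent → Program → Set
    -- prefA a p q : agent a strictly prefers program p to program q
    prefA      : Agent → Program → Program → Set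
    -- prefP p a b : program p strictly prefers agent a to agent b
    prefP      : Program → Agent → Agent → Set
    cost       : Program → ℕ

module _ (I : MinSumC) where
  open MinSumC I

  record Matching : Set where
    field
      assign : Agent → Maybe Program
      valid  : ∀ a p → assign a ≡ just p → Acceptable a p

  PrefersToAssignment : Agent → Program → Maybe Program → Set
  PrefersToAssignment a p nothing  = ⊤
  PrefersToAssignment a p (just q) = prefA a p q

  EnvyFree : Matching → Set
  EnvyFree M = ∀ a p a' → Matching.assign M a ≡ just p → Acceptable a' p →
               prefP p a' a → PrefersToAssignment a' p (Matching.assign M a') → ⊥

  APerfect : Matching → Set
  APerfect M = ∀ a → ∃ λ p → Matching.assign M a ≡ just p

  costOpt : Maybe Program → ℕ
  costOpt nothing  = 0
  costOpt (just p) = cost p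

  matchingCost : Matching → ℕ
  matchingCost M = sum (map (λ a → costOpt (Matching.assign M a)) agents)

-- Strict orders are given by injective rank functions (smaller rank =
-- more preferred).

InjectiveRank : {X : Set} → (X → ℕ) → Set
InjectiveRank {X} r = ∀ (x y : X) → r x ≡ r y → x ≡ y

-- The reduction from Set Cover.  Universe {e_0..e_{n-1}}, sets C_0..C_{m-1},
-- C j : Subset n.

module Reduction (n m : ℕ) (C : Fin m → Subset n)
                 -- a_i's order over {c_j : e_i ∈ C_j}
                 (rkA : Fin n → Fin m → ℕ)
                 -- c_j's order over u_j^1..u_j^n
                 (rkU : Fin m → Fin n → ℕ)
                 -- c_j's order over {a_i : e_i ∈ C_j}
                 (rkE : Fin m → Fin n → ℕ) where

  data Agent : Set where
    elemAgent  : Fin n → Agent           -- a_i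
    dummyAgent : Fin m → Fin n → Agent   -- u_j^l

  data Program : Set where
    subsetProg : Fin m → Program           -- c_j
    dummyProg  : Fin m → Fin n → Program   -- w_j^l

  agentList : List Agent
  agentList = map elemAgent (allFin n)
              Data.List.++ concatMap (λ j → map (dummyAgent j) (allFin n)) (allFin m)

  Acc : Agent → Program → Set
  Acc (elemAgent i)    (subsetProg j)    = i ∈ C j
  Acc (elemAgent i)    (dummyProg _ _)   = ⊥
  Acc (dummyAgent j l) (subsetProg j')   = j' ≡ j
  Acc (dummyAgent j l) (dummyProg j' l') = (j' ≡ j) × (l' ≡ l)

  PA : Agent → Program → Program → Set
  PA (elemAgent i) (subsetProg j) (subsetProg j') =
    (i ∈ C j) × (i ∈ C j') × (rkA i j < rkA i j')
  PA (elemAgent i) _ _ = ⊥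
  PA (dummyAgent j l) p q = (p ≡ subsetProg j) × (q ≡ dummyProg j l)

  PP : Program → Agent → Agent → Set
  PP (subsetProg j) (dummyAgent j₁ l) (dummyAgent j₂ l') =
    (j₁ ≡ j) × (j₂ ≡ j) × (rkU j l < rkU j l')
  PP (subsetProg j) (dummyAgent j₁ l) (elemAgent i) = (j₁ ≡ j) × (i ∈ C j)
  PP (subsetProg j) (elemAgent i) (dummyAgent _ _) = ⊥
  PP (subsetProg j) (elemAgent i) (elemAgent i') =
    (i ∈ C j) × (i' ∈ C j) × (rkE j i < rkE j i')
  -- w_j^l ranks only u_j^l, so it strictly prefers no agent to another
  PP (dummyProg _ _) _ _ = ⊥

  Cost : Program → ℕ
  Cost (subsetProg _)  = 1
  Cost (dummyProg _ _) = 0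

  I' : MinSumC
  I' = record
    { Agent = Agent ; Program = Program ; agents = agentList
    ; Acceptable = Acc ; prefA = PA ; prefP = PP ; cost = Cost }

IsSetCover : {n m : ℕ} → (Fin m → Subset n) → Subset m → Set
IsSetCover {n} {m} C T = ∀ (i : Fin n) → ∃ λ (j : Fin m) → (j ∈ T) × (i ∈ C j)

{-# OPTIONS --safe #-}
-- Given a cover T, send every element-agent a_i to the set of T containing e_i that it ranks
-- highest, and every dummy u_j^l to c_j when C_j ∈ T and to w_j^l otherwise. A subset-program
-- c_j is then occupied only when C_j ∈ T, and every agent who finds such a c_j acceptable is
-- already at least as happy: the dummies of c_j hold their first choice, and an element-agent
-- of C_j could have picked c_j itself. So nobody envies anyone. The cost is n for the
-- element-agents plus n for each of the |T| sets of the cover, i.e. (|T| + 1) n ≤ (k + 1) n.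
module Submission where

open import Defs
open import Data.Nat using (ℕ; suc; _+_; _*_; _≤_; _<_; s≤s)
open import Data.Nat.Properties using (≤-trans; ≤-reflexive; <⇒≱; +-comm; *-comm; *-identityʳ; *-zeroʳ; *-distribˡ-+; *-monoˡ-≤)
open import Data.Nat.ListAction using (sum)
open import Data.Nat.ListAction.Properties using (sum-++)
open import Data.Fin using (Fin)
open import Data.Fin.Subset using (Subset; _∈_; ∣_∣)
open import Data.Fin.Subset.Properties using (_∈?_)
open import Data.Bool using (true; false; if_then_else_)
open import Data.Bool.Properties using (if-float)
open import Data.Vec using ([]; _∷_; lookup)
open import Data.Vec.Properties using ([]=⇒lookup; lookup⇒[]=)
open import Data.List using (List; []; _∷_; _++_; map; concatMap; tabulate; allFin; filter; length)
open import Data.List.Properties using (map-++; map-∘; map-cong; map-tabulate; length-tabulate)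
open import Data.List.Extrema.Nat using (argmin; argmin-all; f[argmin]≤f[xs])
open import Data.List.Membership.Propositional.Properties using (∈-filter⁺; ∈-allFin)
open import Data.List.Relation.Unary.All as All using ()
open import Data.List.Relation.Unary.All.Properties using (all-filter)
open import Data.Maybe using (Maybe; just)
open import Data.Product using (Σ; ∃; _×_; _,_; proj₁; proj₂)
open import Function using (id; const; _∘_)
open import Relation.Nullary using (¬_)
open import Relation.Nullary.Decidable using (_×-dec_)
open import Relation.Unary using (Decidable)
open import Relation.Binary.PropositionalEquality using (_≡_; refl; sym; trans; cong; cong₂; subst; module ≡-Reasoning)

IsArgMin : ∀ {A : Set} → (A → Set) → (A → ℕ) → A → Set
IsArgMin P f x = P x × (∀ {y} → P y → f x ≤ f y)

∃-argmin : ∀ {m} {P : Fin m → Set} → Decidable P → (f : Fin m → ℕ) → ∃ P → ∃ (IsArgMin P f)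
∃-argmin {m} P? f (x , Px) =
  argmin f x candidates ,
  argmin-all f Px (all-filter P? (allFin m)) ,
  λ Py → All.lookup (f[argmin]≤f[xs] x candidates) (∈-filter⁺ P? (∈-allFin _) Py)
  where candidates = filter P? (allFin m)

private
  variable
    A B : Set

sum-map-++ : (f : A → ℕ) (xs ys : List A) → sum (map f (xs ++ ys)) ≡ sum (map f xs) + sum (map f ys)
sum-map-++ f xs ys = trans (cong sum (map-++ f xs ys)) (sum-++ (map f xs) (map f ys))

sum-map-concatMap : (f : B → ℕ) (g : A → List B) (xs : List A) →
                    sum (map f (concatMap g xs)) ≡ sum (map (λ x → sum (map f (g x))) xs)
sum-map-concatMap f g []       = refl
sum-map-concatMap f g (x ∷ xs) =
  trans (sum-map-++ f (g x) (concatMap g xs)) (cong (sum (map f (g x)) +_) (sum-map-concatMap f g xs))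

sum-map-const : (c : ℕ) (xs : List A) → sum (map (const c) xs) ≡ length xs * c
sum-map-const c []       = refl
sum-map-const c (x ∷ xs) = cong (c +_) (sum-map-const c xs)

sum-map-*ˡ : (c : ℕ) (f : A → ℕ) (xs : List A) → sum (map (λ x → c * f x) xs) ≡ c * sum (map f xs)
sum-map-*ˡ c f []       = sym (*-zeroʳ c)
sum-map-*ˡ c f (x ∷ xs) = trans (cong (c * f x +_) (sum-map-*ˡ c f xs)) (sym (*-distribˡ-+ c (f x) _))

sum-allFin-const : ∀ n (c : ℕ) → sum (map (const c) (allFin n)) ≡ n * c
sum-allFin-const n c = trans (sum-map-const c (allFin n)) (cong (_* c) (length-tabulate {n = n} id))

sum-indicator≡∣p∣ : ∀ {m} (p : Subset m) → sum (tabulate (λ j → if lookup p j then 1 else 0)) ≡ ∣ p ∣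
sum-indicator≡∣p∣ []          = refl
sum-indicator≡∣p∣ (true  ∷ p) = cong suc (sum-indicator≡∣p∣ p)
sum-indicator≡∣p∣ (false ∷ p) = sum-indicator≡∣p∣ p

module CoverMatching (n m : ℕ) (C : Fin m → Subset n)
                     (rkA : Fin n → Fin m → ℕ) (rkU : Fin m → Fin n → ℕ) (rkE : Fin m → Fin n → ℕ)
                     (T : Subset m) (cover : IsSetCover C T) where
  open Reduction n m C rkA rkU rkE

  CoveredBy : Fin n → Fin m → Set
  CoveredBy i j = j ∈ T × i ∈ C j

  favourite-isArgMin : ∀ i → ∃ (IsArgMin (CoveredBy i) (rkA i))
  favourite-isArgMin i = ∃-argmin (λ j → j ∈? T ×-dec i ∈? C j) (rkA i) (cover i)

  favourite : Fin n → Fin m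
  favourite i = proj₁ (favourite-isArgMin i)

  favourite-covers : ∀ i → CoveredBy i (favourite i)
  favourite-covers i = proj₁ (proj₂ (favourite-isArgMin i))

  favourite-minimal : ∀ i {j} → CoveredBy i j → rkA i (favourite i) ≤ rkA i j
  favourite-minimal i = proj₂ (proj₂ (favourite-isArgMin i))

  assign : Agent → Maybe Program
  assign (elemAgent i)    = just (subsetProg (favourite i))
  assign (dummyAgent j l) = just (if lookup T j then subsetProg j else dummyProg j l)

  dummyAgent-acceptable : ∀ b j l → Acc (dummyAgent j l) (if b then subsetProg j else dummyProg j l)
  dummyAgent-acceptable true  j l = refl
  dummyAgent-acceptable false j l = refl , refl

  assign-acceptable : ∀ a p → assign a ≡ just p → Acc a p
  assign-acceptable (elemAgent i)    _ refl = proj₂ (favourite-covers i)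
  assign-acceptable (dummyAgent j l) _ refl = dummyAgent-acceptable (lookup T j) j l

  M : Matching I'
  M = record { assign = assign ; valid = assign-acceptable }

  M-APerfect : APerfect I' M
  M-APerfect (elemAgent i)    = _ , refl
  M-APerfect (dummyAgent j l) = _ , refl

  occupied⇒∈T : ∀ a {j} → assign a ≡ just (subsetProg j) → j ∈ T
  occupied⇒∈T (elemAgent i) refl = proj₁ (favourite-covers i)
  occupied⇒∈T (dummyAgent j l) eq with lookup T j in T[j]≡true
  occupied⇒∈T (dummyAgent j l) refl | true = lookup⇒[]= j T T[j]≡true

  elemAgent-¬prefers : ∀ {i j} → j ∈ T → i ∈ C j →
                       ¬ PrefersToAssignment I' (elemAgent i) (subsetProg j) (assign (elemAgent i))
  elemAgent-¬prefers {i} j∈T i∈Cj (_ , _ , j≺favourite) = <⇒≱ j≺favourite (favourite-minimal i (j∈T , i∈Cj))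

  dummyAgent-¬prefers : ∀ {j l} p → j ∈ T → ¬ PrefersToAssignment I' (dummyAgent j l) p (assign (dummyAgent j l))
  dummyAgent-¬prefers p j∈T rewrite []=⇒lookup j∈T = λ { (_ , ()) }

  M-envyFree : EnvyFree I' M
  M-envyFree a (subsetProg j)  (elemAgent i)    a↦cj i∈Cj _ = elemAgent-¬prefers (occupied⇒∈T a a↦cj) i∈Cj
  M-envyFree a (subsetProg j)  (dummyAgent _ _) a↦cj refl _ = dummyAgent-¬prefers (subsetProg j) (occupied⇒∈T a a↦cj)
  M-envyFree a (dummyProg _ _) _                _    _    ()

  agentCost : Agent → ℕ
  agentCost a = costOpt I' (assign a)

  indicatorT : Fin m → ℕ
  indicatorT j = if lookup T j then 1 else 0

  dummyAgents : Fin m → List Agent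
  dummyAgents j = map (dummyAgent j) (allFin n)

  elemAgents-cost : sum (map agentCost (map elemAgent (allFin n))) ≡ n
  elemAgents-cost = begin
    sum (map agentCost (map elemAgent (allFin n))) ≡⟨ cong sum (map-∘ (allFin n)) ⟨
    sum (map (const 1) (allFin n))                 ≡⟨ sum-allFin-const n 1 ⟩
    n * 1                                          ≡⟨ *-identityʳ n ⟩
    n                                              ∎
    where open ≡-Reasoning

  dummyAgents-cost : ∀ j → sum (map agentCost (dummyAgents j)) ≡ n * indicatorT j
  dummyAgents-cost j = begin
    sum (map agentCost (dummyAgents j))                  ≡⟨ cong sum (map-∘ (allFin n)) ⟨
    sum (map (agentCost ∘ dummyAgent j) (allFin n))      ≡⟨ cong sum (map-cong (λ _ → if-float Cost (lookup T j)) (allFin n)) ⟩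
    sum (map (const (indicatorT j)) (allFin n))          ≡⟨ sum-allFin-const n (indicatorT j) ⟩
    n * indicatorT j                                     ∎
    where open ≡-Reasoning

  allDummyAgents-cost : sum (map agentCost (concatMap dummyAgents (allFin m))) ≡ ∣ T ∣ * n
  allDummyAgents-cost = begin
    sum (map agentCost (concatMap dummyAgents (allFin m)))          ≡⟨ sum-map-concatMap agentCost dummyAgents (allFin m) ⟩
    sum (map (λ j → sum (map agentCost (dummyAgents j))) (allFin m)) ≡⟨ cong sum (map-cong dummyAgents-cost (allFin m)) ⟩
    sum (map (λ j → n * indicatorT j) (allFin m))                   ≡⟨ sum-map-*ˡ n indicatorT (allFin m) ⟩
    n * sum (map indicatorT (allFin m))                             ≡⟨ cong (λ s → n * sum s) (map-tabulate id indicatorT) ⟩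
    n * sum (tabulate indicatorT)                                   ≡⟨ cong (n *_) (sum-indicator≡∣p∣ T) ⟩
    n * ∣ T ∣                                                       ≡⟨ *-comm n ∣ T ∣ ⟩
    ∣ T ∣ * n                                                       ∎
    where open ≡-Reasoning

  M-cost : matchingCost I' M ≡ suc ∣ T ∣ * n
  M-cost = trans (sum-map-++ agentCost (map elemAgent (allFin n)) _) (cong₂ _+_ elemAgents-cost allDummyAgents-cost)

mainTheorem4 : (n m : ℕ) (C : Fin m → Subset n) (k : ℕ) → 1 < k →
    (rkA : Fin n → Fin m → ℕ) (rkU : Fin m → Fin n → ℕ) (rkE : Fin m → Fin n → ℕ) →
    (∀ i → InjectiveRank (rkA i)) → (∀ j → InjectiveRank (rkU j)) → (∀ j → InjectiveRank (rkE j)) →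
    (T : Subset m) → IsSetCover C T → ∣ T ∣ ≤ k →
    Σ (Matching (Reduction.I' n m C rkA rkU rkE)) λ M →
      APerfect (Reduction.I' n m C rkA rkU rkE) M ×
      EnvyFree (Reduction.I' n m C rkA rkU rkE) M ×
      matchingCost (Reduction.I' n m C rkA rkU rkE) M ≤ (k + 1) * n
mainTheorem4 n m C k _ rkA rkU rkE _ _ _ T cover ∣T∣≤k =
  M , M-APerfect , M-envyFree , ≤-trans (≤-reflexive M-cost) (*-monoˡ-≤ n suc∣T∣≤k+1)
  where
  open CoverMatching n m C rkA rkU rkE T cover
  suc∣T∣≤k+1 : suc ∣ T ∣ ≤ k + 1
  suc∣T∣≤k+1 = subst (suc ∣ T ∣ ≤_) (+-comm 1 k) (s≤s ∣T∣≤k)
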